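{- Let $G=(V,E)$ be a connected graph with at least two vertices. A vertex set $X\subseteq V$ is a connected vertex cover of $G$ with $X\subseteq M$ for some module $M\in\Pi_{mod}(G)$ if and only if $X=M$ for some $M\in\Pi_{mod}(G)$ such that every edge of $G$ has an endpoint in $M$ and $G[M]$ is connected.
   Context: A connected vertex cover of $G$ is $X\subseteq V$ such that $G-X$ has no edges and $G[X]$ is connected. A module of $G$ is $M\subseteq V$ with $N(v)\setminus M=N(w)\setminus M$ for all $v,w\in M$; strong if for every module $M'$: $M\cap M'=\emptyset$, $M\subseteq M'$ or $M'\subseteq M$. $\Pi_{mod}(G)$ is the partition of $V$ into the inclusion-maximal strong modules different from $V$. -}

module Defs where

open import Data.Nat using (ℕ)
open import Data.Fin using (Fin)
open import Data.Fin.Subset using (Subset; _∈_; _∉_; _⊆_; ⊤)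
open import Data.Product using (_×_; ∃-syntax)
open import Data.Sum using (_⊎_)
open import Relation.Nullary using (¬_)
open import Relation.Binary using (Rel; Decidable; Symmetric; Irreflexive)
open import Relation.Binary.PropositionalEquality using (_≡_)
open import Level using (0ℓ)

record Graph (n : ℕ) : Set₁ where
  field
    E     : Rel (Fin n) 0ℓ
    sym   : Symmetric E
    irr   : Irreflexive _≡_ E
    dec   : Decidable E
open Graph public

module _ {n : ℕ} (G : Graph n) where

  data Reach (X : Subset n) : Fin n → Fin n → Set where
    here : ∀ {u} → u ∈ X → Reach X u u
    step : ∀ {u w v} → u ∈ X → E G u w → Reach X w v → Reach X u v

  Connected : Subset n → Set
  Connected X = ∀ u v → u ∈ X → v ∈ X → Reach X u v

  IsVertexCover : Subset n → Set
  IsVertexCover X = ∀ u v → E G u v → u ∈ X ⊎ v ∈ X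

  IsConnectedVertexCover : Subset n → Set
  IsConnectedVertexCover X = IsVertexCover X × Connected X

  IsModule : Subset n → Set
  IsModule M = ∀ v w u → v ∈ M → w ∈ M → u ∉ M → E G v u → E G w u

  Disjoint : Subset n → Subset n → Set
  Disjoint A B = ∀ x → x ∈ A → x ∉ B

  IsStrongModule : Subset n → Set
  IsStrongModule M = IsModule M ×
    (∀ M′ → IsModule M′ → Disjoint M M′ ⊎ (M ⊆ M′ ⊎ M′ ⊆ M))

  InΠmod : Subset n → Set
  InΠmod M = IsStrongModule M × ¬ (M ≡ ⊤) ×
    (∀ M′ → IsStrongModule M′ → ¬ (M′ ≡ ⊤) → M ⊆ M′ → M′ ⊆ M)

-- A connected vertex cover X inside a module M ∈ Π_mod(G) must be all of M: if some
-- v ∈ M were uncovered, every vertex u outside M would have a neighbour in X ⊆ M, so by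
-- the module property u would be adjacent to v, and the edge uv would be uncovered.
-- Hence M would be V, which Π_mod(G) excludes.
module Submission where

open import Defs
open import Data.Nat using (ℕ; _≤_)
open import Data.Fin.Subset using (Subset; _⊆_; ⊤; _∈_; _∉_)
open import Data.Fin.Subset.Properties using (_∈?_; ∈⊤; ⊆⊤; ⊆-refl; ⊆-antisym)
open import Data.Product using (_×_; ∃-syntax; _,_)
open import Data.Sum using (inj₁; inj₂)
open import Function using (_∘_)
open import Function.Bundles using (_⇔_; mk⇔)
open import Relation.Nullary using (contradiction)
open import Relation.Nullary.Decidable using (decidable-stable)
open import Relation.Binary.PropositionalEquality using (_≡_; _≢_; refl; subst)

module _ {n : ℕ} (G : Graph n) where

  cover-∋-neighbour : ∀ {X u w} → IsVertexCover G X → u ∉ X → E G u w → w ∈ X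
  cover-∋-neighbour vc u∉X euw with vc _ _ euw
  ... | inj₁ u∈X = contradiction u∈X u∉X
  ... | inj₂ w∈X = w∈X

  reach-distinct⇒neighbour : ∀ {X u v} → Reach G X u v → u ≢ v → ∃[ w ] E G u w
  reach-distinct⇒neighbour (here _)       u≢u = contradiction refl u≢u
  reach-distinct⇒neighbour (step _ euw _) _   = _ , euw

  module-with-uncovered-vertex⇒full : ∀ {X M v} → Connected G ⊤ → IsVertexCover G X →
    IsModule G M → X ⊆ M → v ∈ M → v ∉ X → ∀ u → u ∈ M
  module-with-uncovered-vertex⇒full {M = M} {v} conn vc mod X⊆M v∈M v∉X u =
    decidable-stable (u ∈? M) λ u∉M →
      let u∉X       = u∉M ∘ X⊆M
          (w , euw) = reach-distinct⇒neighbour (conn u v ∈⊤ ∈⊤) λ { refl → u∉M v∈M }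
          w∈M       = X⊆M (cover-∋-neighbour vc u∉X euw)
          evu       = mod w v u w∈M v∈M u∉M (sym G euw)
      in v∉X (cover-∋-neighbour vc u∉X (sym G evu))

  cover⊆proper-module⇒≡ : ∀ {X M} → Connected G ⊤ → IsVertexCover G X →
    IsModule G M → M ≢ ⊤ → X ⊆ M → X ≡ M
  cover⊆proper-module⇒≡ {X} conn vc mod M≢⊤ X⊆M = ⊆-antisym X⊆M λ {v} v∈M →
    decidable-stable (v ∈? X) λ v∉X →
      M≢⊤ (⊆-antisym ⊆⊤ λ {u} _ →
        module-with-uncovered-vertex⇒full conn vc mod X⊆M v∈M v∉X u)

lemma16 : (n : ℕ) (G : Graph n) → 2 ≤ n → Connected G ⊤ → (X : Subset n) →
    (IsConnectedVertexCover G X × ∃[ M ] (InΠmod G M × X ⊆ M))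
    ⇔ (∃[ M ] (InΠmod G M × X ≡ M × IsVertexCover G M × Connected G M))
lemma16 n G _ conn X = mk⇔
  (λ { ((vc , conX) , M , M∈Π@((mod , _) , M≢⊤ , _) , X⊆M) →
       let X≡M = cover⊆proper-module⇒≡ G conn vc mod M≢⊤ X⊆M
       in M , M∈Π , X≡M , subst (IsVertexCover G) X≡M vc , subst (Connected G) X≡M conX })
  (λ { (M , M∈Π , refl , vc , conM) → (vc , conM) , M , M∈Π , ⊆-refl })
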